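{- There exist residuated lattices $A$ that satisfy $\neg a\vee\neg\neg a=1$ for all $a\in A$ and that are not Stone.
   Context: A residuated lattice is an algebra $(A,\vee,\wedge,\odot,\rightarrow,0,1)$ with $(A,\vee,\wedge,0,1)$ a bounded lattice, $(A,\odot,1)$ a commutative monoid and $a\le b\rightarrow c$ iff $a\odot b\le c$; $\neg a=a\rightarrow 0$ and $a^n$ is the $n$-fold $\odot$-power. $B(A)$ is the set of complemented elements of $A$; $a^{\top}=\{b\in A\mid a\vee b=1\}$; $\langle e\rangle=\{b\in A\mid e^n\le b\text{ for some }n\ge1\}$. $A$ is Stone iff for every $a\in A$ there is $e\in B(A)$ with $a^{\top}=\langle e\rangle$. -}

module Defs where

open import Level using (Level; suc; _⊔_)
open import Data.Nat using (ℕ) renaming (suc to sucℕ; zero to zeroℕ)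
open import Data.Product using (Σ; ∃; _×_; _,_)
open import Relation.Binary.PropositionalEquality using (_≡_)
open import Function.Bundles using (_⇔_)
open import Algebra.Structures using (IsCommutativeMonoid)
open import Relation.Binary.Lattice.Structures using (IsLattice)
open import Relation.Binary.Structures using (IsPartialOrder)

record ResiduatedLattice (c : Level) : Set (suc c) where
  infixr 6 _∨_
  infixr 7 _∧_
  infixr 7 _⊙_
  infixr 5 _⇒_
  infix 4 _≤_
  field
    Carrier : Set c
    _≤_ : Carrier → Carrier → Set c
    _∨_ _∧_ _⊙_ _⇒_ : Carrier → Carrier → Carrier
    𝟘 𝟙 : Carrier
    isLattice : IsLattice _≡_ _≤_ _∨_ _∧_
    minimum : ∀ x → 𝟘 ≤ x
    maximum : ∀ x → x ≤ 𝟙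
    ⊙-isCommutativeMonoid : IsCommutativeMonoid _≡_ _⊙_ 𝟙
    residuation : ∀ a b c → (a ≤ (b ⇒ c)) ⇔ ((a ⊙ b) ≤ c)

  ¬_ : Carrier → Carrier
  ¬ a = a ⇒ 𝟘

  _^_ : Carrier → ℕ → Carrier
  a ^ zeroℕ = 𝟙
  a ^ sucℕ n = a ⊙ (a ^ n)

  IsComplemented : Carrier → Set c
  IsComplemented e = Σ Carrier λ f → (e ∨ f ≡ 𝟙) × (e ∧ f ≡ 𝟘)

  _∈⊤_ : Carrier → Carrier → Set c
  b ∈⊤ a = a ∨ b ≡ 𝟙

  _∈⟨_⟩ : Carrier → Carrier → Set c
  b ∈⟨ e ⟩ = Σ ℕ λ n → (e ^ sucℕ n) ≤ b

  IsStone : Set c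
  IsStone = ∀ a → Σ Carrier λ e → IsComplemented e × (∀ b → (b ∈⊤ a) ⇔ (b ∈⟨ e ⟩))

-- The counterexample is the five-element Heyting algebra 0 < c < a, b < 1 with
-- a ∧ b = c and a ∨ b = 1, made residuated by taking ⊙ = ∧. Every x ≠ 0 lies
-- above the atom c, so ¬x is 1 for x = 0 and 0 otherwise, and ¬x ∨ ¬¬x = 1.
-- But the only complemented elements are 0 and 1, whose filters ⟨0⟩ = A and
-- ⟨1⟩ = {1} both differ from a^⊤ = {b, 1}.
module Submission where

open import Defs
open import Level using (Level; 0ℓ)
open import Data.Nat as ℕ using (ℕ)
open import Data.Product using (Σ; _×_; _,_)
open import Data.Sum using (_⊎_; inj₁; inj₂)
open import Function.Bundles using (mk⇔; module Equivalence)
open import Relation.Binary.PropositionalEquality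
  using (_≡_; refl; sym; trans; cong; cong₂; subst; isEquivalence)
open import Relation.Nullary using (¬_; Dec)
open import Relation.Nullary.Decidable
  using (map′; from-yes; _×-dec_; _⊎-dec_; _→-dec_)
open import Algebra.Structures using (IsCommutativeMonoid)
open import Relation.Binary.Lattice.Structures using (IsLattice)

module _ {ℓ : Level} (L : ResiduatedLattice ℓ) where

  open ResiduatedLattice L
  open IsCommutativeMonoid ⊙-isCommutativeMonoid using (identityˡ; identityʳ)
  open IsLattice isLattice using (antisym)

  𝟙^n≡𝟙 : ∀ n → 𝟙 ^ n ≡ 𝟙
  𝟙^n≡𝟙 ℕ.zero    = refl
  𝟙^n≡𝟙 (ℕ.suc n) = trans (identityˡ (𝟙 ^ n)) (𝟙^n≡𝟙 n)

  ∈⟨𝟙⟩⇒≡𝟙 : ∀ {b} → b ∈⟨ 𝟙 ⟩ → b ≡ 𝟙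
  ∈⟨𝟙⟩⇒≡𝟙 {b} (n , 𝟙^n≤b) = antisym (maximum b) (subst (_≤ b) (𝟙^n≡𝟙 (ℕ.suc n)) 𝟙^n≤b)

  ∈⟨𝟘⟩ : ∀ b → b ∈⟨ 𝟘 ⟩
  ∈⟨𝟘⟩ b = 0 , subst (_≤ b) (sym (identityʳ 𝟘)) (minimum b)

data E : Set where
  bot c a b top : E

index : E → ℕ
index bot = 0
index c   = 1
index a   = 2
index b   = 3
index top = 4

fromIndex : ℕ → E
fromIndex 0 = bot
fromIndex 1 = c
fromIndex 2 = a
fromIndex 3 = b
fromIndex _ = top

fromIndex-index : ∀ x → fromIndex (index x) ≡ x
fromIndex-index bot = refl
fromIndex-index c   = refl
fromIndex-index a   = refl
fromIndex-index b   = refl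
fromIndex-index top = refl

index-injective : ∀ {x y} → index x ≡ index y → x ≡ y
index-injective {x} {y} eq =
  trans (sym (fromIndex-index x)) (trans (cong fromIndex eq) (fromIndex-index y))

infix 4 _≟_
_≟_ : (x y : E) → Dec (x ≡ y)
x ≟ y = map′ index-injective (cong index) (index x ℕ.≟ index y)

∀? : {P : E → Set} → (∀ x → Dec (P x)) → Dec (∀ x → P x)
∀? P? = map′ (λ { (p₀ , pc , pa , pb , p₁) → λ { bot → p₀ ; c → pc ; a → pa ; b → pb ; top → p₁ } })
             (λ p → p bot , p c , p a , p b , p top)
             (P? bot ×-dec P? c ×-dec P? a ×-dec P? b ×-dec P? top)

infixr 7 _⊓_
infixr 6 _⊔_
infixr 5 _⇒_
infix 4 _≤_

_⊓_ : E → E → E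
top ⊓ y   = y
x   ⊓ top = x
bot ⊓ _   = bot
_   ⊓ bot = bot
a   ⊓ a   = a
b   ⊓ b   = b
_   ⊓ _   = c

_⊔_ : E → E → E
bot ⊔ y   = y
x   ⊔ bot = x
c   ⊔ y   = y
x   ⊔ c   = x
a   ⊔ a   = a
b   ⊔ b   = b
_   ⊔ _   = top

_⇒_ : E → E → E
_   ⇒ top = top
bot ⇒ _   = top
top ⇒ y   = y
_   ⇒ bot = bot
c   ⇒ _   = top
a   ⇒ a   = top
a   ⇒ _   = b
b   ⇒ b   = top
b   ⇒ _   = a

_≤_ : E → E → Set
x ≤ y = x ⊓ y ≡ x

infix 4 _≤?_
_≤?_ : (x y : E) → Dec (x ≤ y)
x ≤? y = x ⊓ y ≟ x

open Equivalence using (to; from)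

E-residuatedLattice : ResiduatedLattice 0ℓ
E-residuatedLattice = record
  { Carrier = E ; _≤_ = _≤_ ; _∨_ = _⊔_ ; _∧_ = _⊓_ ; _⊙_ = _⊓_ ; _⇒_ = _⇒_
  ; 𝟘 = bot ; 𝟙 = top
  ; isLattice = record
    { isPartialOrder = record
      { isPreorder = record
        { isEquivalence = isEquivalence
        ; reflexive = λ { {x} refl → ⊓-idem x }
        ; trans = λ {x y z} → ≤-trans x y z }
      ; antisym = λ {x y} → ≤-antisym x y }
    ; supremum = ⊔-supremum
    ; infimum = ⊓-infimum }
  ; minimum = from-yes (∀? λ x → bot ≤? x)
  ; maximum = from-yes (∀? λ x → x ≤? top)
  ; ⊙-isCommutativeMonoid = record
    { isMonoid = record
      { isSemigroup = record
        { isMagma = record { isEquivalence = isEquivalence ; ∙-cong = cong₂ _⊓_ }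
        ; assoc = from-yes (∀? λ x → ∀? λ y → ∀? λ z → (x ⊓ y) ⊓ z ≟ x ⊓ (y ⊓ z)) }
      ; identity = from-yes (∀? λ x → top ⊓ x ≟ x) , from-yes (∀? λ x → x ⊓ top ≟ x) }
    ; comm = from-yes (∀? λ x → ∀? λ y → x ⊓ y ≟ y ⊓ x) }
  ; residuation = λ x y z → mk⇔ (⇒-residualʳ x y z) (⇒-residualˡ x y z)
  }
  where
  ⊓-idem : ∀ x → x ⊓ x ≡ x
  ⊓-idem = from-yes (∀? λ x → x ⊓ x ≟ x)

  ≤-trans : ∀ x y z → x ≤ y → y ≤ z → x ≤ z
  ≤-trans = from-yes (∀? λ x → ∀? λ y → ∀? λ z → x ≤? y →-dec y ≤? z →-dec x ≤? z)

  ≤-antisym : ∀ x y → x ≤ y → y ≤ x → x ≡ y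
  ≤-antisym = from-yes (∀? λ x → ∀? λ y → x ≤? y →-dec y ≤? x →-dec x ≟ y)

  ⊔-supremum : ∀ x y → x ≤ x ⊔ y × y ≤ x ⊔ y × (∀ z → x ≤ z → y ≤ z → x ⊔ y ≤ z)
  ⊔-supremum = from-yes (∀? λ x → ∀? λ y →
    x ≤? x ⊔ y ×-dec y ≤? x ⊔ y ×-dec ∀? λ z → x ≤? z →-dec y ≤? z →-dec x ⊔ y ≤? z)

  ⊓-infimum : ∀ x y → x ⊓ y ≤ x × x ⊓ y ≤ y × (∀ z → z ≤ x → z ≤ y → z ≤ x ⊓ y)
  ⊓-infimum = from-yes (∀? λ x → ∀? λ y →
    x ⊓ y ≤? x ×-dec x ⊓ y ≤? y ×-dec ∀? λ z → z ≤? x →-dec z ≤? y →-dec z ≤? x ⊓ y)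

  ⇒-residualʳ : ∀ x y z → x ≤ y ⇒ z → x ⊓ y ≤ z
  ⇒-residualʳ = from-yes (∀? λ x → ∀? λ y → ∀? λ z → x ≤? y ⇒ z →-dec x ⊓ y ≤? z)

  ⇒-residualˡ : ∀ x y z → x ⊓ y ≤ z → x ≤ y ⇒ z
  ⇒-residualˡ = from-yes (∀? λ x → ∀? λ y → ∀? λ z → x ⊓ y ≤? z →-dec x ≤? y ⇒ z)

¬x⊔¬¬x≡top : ∀ x → (x ⇒ bot) ⊔ ((x ⇒ bot) ⇒ bot) ≡ top
¬x⊔¬¬x≡top = from-yes (∀? λ x → (x ⇒ bot) ⊔ ((x ⇒ bot) ⇒ bot) ≟ top)

complemented⇒bot-or-top : ∀ e f → e ⊔ f ≡ top → e ⊓ f ≡ bot → e ≡ bot ⊎ e ≡ top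
complemented⇒bot-or-top = from-yes (∀? λ e → ∀? λ f →
  e ⊔ f ≟ top →-dec e ⊓ f ≟ bot →-dec (e ≟ bot ⊎-dec e ≟ top))

E-notStone : ¬ ResiduatedLattice.IsStone E-residuatedLattice
E-notStone isStone with isStone a
... | e , (f , e⊔f≡top , e⊓f≡bot) , a^⊤≡⟨e⟩
    with complemented⇒bot-or-top e f e⊔f≡top e⊓f≡bot
...   | inj₁ refl = a⊔a≢top (from (a^⊤≡⟨e⟩ a) (∈⟨𝟘⟩ E-residuatedLattice a))
  where
  a⊔a≢top : ¬ a ⊔ a ≡ top
  a⊔a≢top ()
...   | inj₂ refl = b≢top (∈⟨𝟙⟩⇒≡𝟙 E-residuatedLattice (to (a^⊤≡⟨e⟩ b) refl))
  where
  b≢top : ¬ b ≡ top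
  b≢top ()

mainTheorem16 : Σ (ResiduatedLattice 0ℓ) λ A →
    (∀ a → ResiduatedLattice._∨_ A (ResiduatedLattice.¬_ A a) (ResiduatedLattice.¬_ A (ResiduatedLattice.¬_ A a)) ≡ ResiduatedLattice.𝟙 A)
    × ¬ ResiduatedLattice.IsStone A
mainTheorem16 = E-residuatedLattice , ¬x⊔¬¬x≡top , E-notStone
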